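{- Let $R_n$ be a regular hexagon with side length $n$ in the triangular lattice. Then the minimum maximum excess of $R_n$, taken over all orderings of the black triangles of $R_n$, is equal to $n$.
   Context: The triangular lattice tiles the plane by unit equilateral triangles; upward-pointing triangles are black and downward-pointing triangles are white. $R_n$ is the union of lattice triangles forming a regular hexagon with side length $n$. For a set $U$ of black triangles of $R_n$, $N(U)$ is the set of white triangles of $R_n$ sharing an edge with at least one triangle of $U$, and the excess is $e(U)=|N(U)|-|U|$. For an ordering $b_1,\dots,b_m$ of all black triangles of $R_n$, let $B_k=\{b_1,\dots,b_k\}$; the maximum excess of the ordering is $\max_{1\le k\le m} e(B_k)$. The minimum maximum excess of $R_n$ is the minimum of the maximum excess over all orderings of the black triangles. -}

module Defs where

open import Data.Nat using (ℕ; zero; suc; _+_; _*_; _≤ᵇ_; _≡ᵇ_)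
open import Data.Bool using (Bool; true; false; _∧_; _∨_)
open import Data.Product using (_×_; _,_)
open import Data.List using (List; []; _∷_; length; map; concatMap; upTo; take; foldr)
open import Data.Bool.ListAction using (any)
open import Data.List.Relation.Binary.Permutation.Propositional using (_↭_)
open import Data.Integer using (ℤ; +_; _-_; _⊔_)

-- Lattice points are a·e₁ + b·e₂ (e₁, e₂ unit vectors at 60°).
-- The black (upward) triangle with label (a , b) has vertices
--   (a,b), (a+1,b), (a,b+1);
-- the white (downward) triangle with label (a , b) has vertices
--   (a+1,b), (a,b+1), (a+1,b+1).
-- The regular hexagon R_n of side n (translated so that all coordinates are
-- natural numbers) is the region { (x,y) : 0 ≤ x ≤ 2n, 0 ≤ y ≤ 2n, n ≤ x+y ≤ 3n }.
-- A lattice triangle belongs to R_n iff all three of its vertices lie in it.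

Tri : Set
Tri = ℕ × ℕ

inHex : ℕ → ℕ → ℕ → Bool
inHex n x y = (x ≤ᵇ 2 * n) ∧ (y ≤ᵇ 2 * n) ∧ (n ≤ᵇ x + y) ∧ (x + y ≤ᵇ 3 * n)

blackIn : ℕ → Tri → Bool
blackIn n (a , b) = inHex n a b ∧ inHex n (suc a) b ∧ inHex n a (suc b)

whiteIn : ℕ → Tri → Bool
whiteIn n (a , b) = inHex n (suc a) b ∧ inHex n a (suc b) ∧ inHex n (suc a) (suc b)

-- all candidate labels (a , b) with a , b ≤ 2n (every triangle of R_n has such a label)
grid : ℕ → List Tri
grid n = concatMap (λ a → map (λ b → (a , b)) (upTo (suc (2 * n)))) (upTo (suc (2 * n)))

filterᵇ : {A : Set} → (A → Bool) → List A → List A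
filterᵇ p [] = []
filterᵇ p (x ∷ xs) with p x
... | true  = x ∷ filterᵇ p xs
... | false = filterᵇ p xs

blacks : ℕ → List Tri
blacks n = filterᵇ (blackIn n) (grid n)

whites : ℕ → List Tri
whites n = filterᵇ (whiteIn n) (grid n)

eqTri : Tri → Tri → Bool
eqTri (a , b) (c , d) = (a ≡ᵇ c) ∧ (b ≡ᵇ d)

-- black (a,b) and white (c,d) share an edge iff
--   (c,d) = (a,b)     [common edge (a+1,b)-(a,b+1)]
--   (c+1,d) = (a,b)   [common edge (a,b)-(a,b+1)]
--   (c,d+1) = (a,b)   [common edge (a,b)-(a+1,b)]
adjacent : Tri → Tri → Bool
adjacent (a , b) (c , d) =
  eqTri (a , b) (c , d) ∨ eqTri (a , b) (suc c , d) ∨ eqTri (a , b) (c , suc d)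

nbhd : ℕ → List Tri → List Tri
nbhd n U = filterᵇ (λ w → any (λ u → adjacent u w) U) (whites n)

excess : ℕ → List Tri → ℤ
excess n U = (+ length (nbhd n U)) - (+ length U)

prefixExcesses : ℕ → List Tri → List ℤ
prefixExcesses n σ = map (λ k → excess n (take (suc k) σ)) (upTo (length σ))

Ordering : ℕ → List Tri → Set
Ordering n σ = σ ↭ blacks n

-- maximum excess of an ordering σ:  max_{1 ≤ k ≤ m} e(B_k)
-- (for m ≥ 1 the first entry seeds the maximum, so the result is the genuine maximum)
maxExcess : ℕ → List Tri → ℤ
maxExcess n σ with prefixExcesses n σ
... | []     = + 0
... | x ∷ xs = foldr _⊔_ x xs

{-# OPTIONS --safe #-}
module Submission where

-- Upper bound: list the black triangles lexicographically.  Every prefix U is then closed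
-- downwards, so a white neighbour of U either has the label of an element of U or is one of the
-- n white triangles (c , d) with c + d + 1 = n along the lower left edge; hence e(U) ≤ n.
--
-- Lower bound: in each of the three lattice directions the black triangles of R_n lie on 2n
-- lines, n of them white-ended (a white triangle lies beyond each end) and n black-ended.  In
-- any ordering let B_k be the first prefix containing a whole black-ended line L.  Then b_k lies
-- on L and on a white-ended line of a second direction, all n of whose white-ended lines cross
-- L.  In that direction B_k meets every white-ended line and contains no black-ended line that
-- it meets.  Sending each element of B_k to its white neighbour on its own line, towards a black
-- triangle missing from B_k (leftwards on white-ended lines), and each white-ended line to the
-- white triangle beyond its last element of B_k, is injective; hence e(B_k) ≥ n.

module HexagonExcess where

  open import Defs
  open import Data.Bool using (Bool; true; false; T)
  open import Data.Bool.ListAction using (any)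
  open import Data.Bool.Properties using (T-∧; T-∨)
  open import Data.Empty using (⊥)
  open import Data.Integer as ℤ using (+_; _-_; _⊖_; _⊔_)
  import Data.Integer.Properties as ℤ
  open import Data.List
    using (List; []; _∷_; _++_; length; map; filter; upTo; take; foldr; concatMap; cartesianProduct)
  open import Data.List.Extrema.Nat using (max; xs≤max; argmax-sel)
  open import Data.List.Membership.Propositional using (_∈_; _∉_; find; lose)
  open import Data.List.Membership.Propositional.Properties
    using ( ∈-++⁺ˡ; ∈-++⁺ʳ; ∈-++⁻; ∈-∃++; ∈-map⁺; ∈-map⁻; ∈-filter⁺; ∈-filter⁻; ∈-upTo⁺; ∈-upTo⁻
          ; ∈-cartesianProduct⁺; ∈-cartesianProduct⁻)
  open import Data.List.Properties
    using (length-++; length-map; length-upTo; take-all; foldr-preservesᵇ; foldr-preservesᵒ)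
  open import Data.List.Relation.Binary.Permutation.Propositional using (↭-sym; ↭⇒↭ₛ)
  open import Data.List.Relation.Binary.Permutation.Propositional.Properties using (∈-resp-↭)
  open import Data.List.Relation.Binary.Subset.Propositional using (_⊆_)
  open import Data.List.Relation.Unary.All as All using (All; []; _∷_)
  import Data.List.Relation.Unary.All.Properties as All
  open import Data.List.Relation.Unary.AllPairs as AllPairs using (AllPairs; []; _∷_)
  import Data.List.Relation.Unary.AllPairs.Properties as AllPairs
  open import Data.List.Relation.Unary.Any as Any using (Any; here; there; toSum; any?)
  open import Data.List.Relation.Unary.Any.Properties using (any⁺; any⁻)
  open import Data.List.Relation.Unary.Unique.Propositional using (Unique)
  import Data.List.Relation.Unary.Unique.Propositional.Properties as Unique
  open import Data.Nat as ℕ using (ℕ; zero; suc; _+_; _*_; _∸_; _≤_; _<_; z≤n; s≤s; _≤?_; _<?_; _≟_)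
  open import Data.Nat.Properties
  open import Data.Product using (_×_; _,_; proj₁; proj₂; ∃-syntax; swap)
  open import Data.Product.Properties using (≡-dec; ×-≡,≡→≡)
  open import Data.Product.Relation.Binary.Lex.Strict using (×-Lex; ×-asymmetric)
  open import Data.Sum using (_⊎_; inj₁; inj₂; [_,_])
  open import Function using (_∘_; id; case_of_; Equivalence)
  open import Level using (0ℓ)
  open import Relation.Binary using (Rel; Asymmetric)
  open import Relation.Binary.PropositionalEquality hiding ([_])
  open import Relation.Nullary using (¬_; ¬?; Dec; yes; no; contradiction)
  open import Relation.Nullary.Decidable using (T?; _×-dec_)
  open import Relation.Unary using (Decidable)
  open import Data.List.Membership.DecPropositional (≡-dec _≟_ _≟_) using (_∈?_)
  open import Data.List.Relation.Binary.Permutation.Setoid.Properties (setoid Tri) using (Unique-resp-↭)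

  open Equivalence using (to; from)

  private
    variable
      A B : Set
      n : ℕ
      u w : Tri
      xs ys : List A

  filterᵇ≡filter : ∀ (p : A → Bool) xs → filterᵇ p xs ≡ filter (T? ∘ p) xs
  filterᵇ≡filter p [] = refl
  filterᵇ≡filter p (x ∷ xs) with p x
  ... | true  = cong (x ∷_) (filterᵇ≡filter p xs)
  ... | false = filterᵇ≡filter p xs

  concatMap-pairs≡cartesianProduct : ∀ (xs : List A) (ys : List B) →
                                     concatMap (λ a → map (a ,_) ys) xs ≡ cartesianProduct xs ys
  concatMap-pairs≡cartesianProduct []       ys = refl
  concatMap-pairs≡cartesianProduct (x ∷ xs) ys =
    cong (map (x ,_) ys ++_) (concatMap-pairs≡cartesianProduct xs ys)

  cartesianProduct-sorted : ∀ {R : Rel A 0ℓ} {S : Rel B 0ℓ} → AllPairs R xs → AllPairs S ys →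
                            AllPairs (×-Lex _≡_ R S) (cartesianProduct xs ys)
  cartesianProduct-sorted [] _ = []
  cartesianProduct-sorted {xs = x ∷ xs} {ys} (x<xs ∷ xs-sorted) ys-sorted =
    AllPairs.++⁺ (AllPairs.map⁺ (AllPairs.map (λ b<b′ → inj₂ (refl , b<b′)) ys-sorted))
                 (cartesianProduct-sorted xs-sorted ys-sorted)
                 (All.map⁺ (All.tabulate λ _ → All.tabulate λ p∈ →
                    inj₁ (All.lookup x<xs (proj₁ (∈-cartesianProduct⁻ xs ys p∈)))))

  upTo-sorted : ∀ m → AllPairs _<_ (upTo m)
  upTo-sorted m = AllPairs.applyUpTo⁺₁ id m (λ i<j _ → i<j)

  take-lowerClosed : ∀ {R : Rel A 0ℓ} {k xs x y} → Asymmetric R → AllPairs R xs →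
                     y ∈ take k xs → x ∈ xs → R x y → x ∈ take k xs
  take-lowerClosed {k = suc k} {z ∷ zs} asym (z<zs ∷ _) (here refl) (there x∈zs) x<z =
    contradiction (All.lookup z<zs x∈zs) (asym x<z)
  take-lowerClosed {k = suc k} {z ∷ zs} asym _ _ (here refl) _ = here refl
  take-lowerClosed {k = suc k} {z ∷ zs} asym (_ ∷ sorted) (there y∈) (there x∈zs) x<y =
    there (take-lowerClosed asym sorted y∈ x∈zs x<y)

  take-suc-⊆ : ∀ (xs : List A) {k} → k < length xs → ∃[ x ] take (suc k) xs ⊆ x ∷ take k xs
  take-suc-⊆ (y ∷ ys) {zero}  _           = y , id
  take-suc-⊆ (y ∷ ys) {suc k} (s≤s k<len) with x , sub ← take-suc-⊆ ys k<len = x , λ where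
    (here refl) → there (here refl)
    (there u∈)  → case sub u∈ of λ where
      (here refl) → here refl
      (there u∈′) → there (there u∈′)

  first-prefix : ∀ {P : List A → Set} → Decidable P → ¬ P [] → P xs →
                 ∃[ k ] k < length xs × ¬ P (take k xs) × P (take (suc k) xs)
  first-prefix {xs = xs} {P} P? ¬P[] Pxs =
    search (length xs) ≤-refl (subst P (sym (take-all (length xs) xs ≤-refl)) Pxs)
    where
    search : ∀ k → k ≤ length xs → P (take k xs) →
             ∃[ j ] j < length xs × ¬ P (take j xs) × P (take (suc j) xs)
    search zero    _     P[]  = contradiction P[] ¬P[]
    search (suc k) k<len Pk+1 with P? (take k xs)
    ... | yes Pk = search k (<⇒≤ k<len) Pk
    ... | no ¬Pk = k , k<len , ¬Pk , Pk+1

  ∈-∷∧∉⇒≡ : ∀ {x y : A} → y ∈ x ∷ xs → y ∉ xs → y ≡ x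
  ∈-∷∧∉⇒≡ (here y≡x)   _    = y≡x
  ∈-∷∧∉⇒≡ (there y∈xs) y∉xs = contradiction y∈xs y∉xs

  ∈-++-∷⁻ : ∀ {x y : A} as {bs} → y ∈ as ++ x ∷ bs → y ≢ x → y ∈ as ++ bs
  ∈-++-∷⁻ as y∈ y≢x with ∈-++⁻ as y∈
  ... | inj₁ y∈as         = ∈-++⁺ˡ y∈as
  ... | inj₂ (here y≡x)   = contradiction y≡x y≢x
  ... | inj₂ (there y∈bs) = ∈-++⁺ʳ as y∈bs

  length-≤-⊆ : Unique xs → xs ⊆ ys → length xs ≤ length ys
  length-≤-⊆ [] _ = z≤n
  length-≤-⊆ {xs = x ∷ xs} (x∉xs ∷ xs-unique) xs⊆ys
    with as , bs , refl ← ∈-∃++ (xs⊆ys (here refl)) =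
    begin
      suc (length xs)             ≤⟨ s≤s (length-≤-⊆ xs-unique xs⊆as++bs) ⟩
      suc (length (as ++ bs))     ≡⟨ cong suc (length-++ as) ⟩
      suc (length as + length bs) ≡⟨ sym (+-suc (length as) (length bs)) ⟩
      length as + length (x ∷ bs) ≡⟨ sym (length-++ as) ⟩
      length (as ++ x ∷ bs)       ∎
    where
    open ≤-Reasoning
    xs⊆as++bs : xs ⊆ as ++ bs
    xs⊆as++bs y∈xs = ∈-++-∷⁻ as (xs⊆ys (there y∈xs)) (λ y≡x → All.lookup x∉xs y∈xs (sym y≡x))

  Unique-map⁺ : ∀ {f : A → B} → Unique xs → (∀ {x y} → x ∈ xs → y ∈ xs → f x ≡ f y → x ≡ y) →
                Unique (map f xs)
  Unique-map⁺ [] _ = []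
  Unique-map⁺ (x∉xs ∷ xs-unique) f-inj =
    All.map⁺ (All.tabulate λ y∈xs fx≡fy → All.lookup x∉xs y∈xs (f-inj (here refl) (there y∈xs) fx≡fy))
    ∷ Unique-map⁺ xs-unique (λ x∈ y∈ → f-inj (there x∈) (there y∈))

  ∈-map-witness : ∀ {f : A → B} {y} → ∃[ x ] x ∈ xs × f x ≡ y → y ∈ map f xs
  ∈-map-witness {f = f} (x , x∈xs , refl) = ∈-map⁺ f x∈xs

  ≤-foldr-⊔ : ∀ {z} x xs → z ∈ x ∷ xs → z ℤ.≤ foldr _⊔_ x xs
  ≤-foldr-⊔ x xs z∈ =
    foldr-preservesᵒ (λ x y → [ ℤ.i≤j⇒i≤j⊔k y , ℤ.i≤j⇒i≤k⊔j x ]) x xs (toSum (Any.map ℤ.≤-reflexive z∈))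

  [m+n]⊖n≡m : ∀ m n → (m + n) ⊖ n ≡ + m
  [m+n]⊖n≡m m n = trans (ℤ.⊖-≥ (m≤n+m n m)) (cong +_ (m+n∸n≡m m n))

  m+n≤o⇒m≤o-n : ∀ {m n o} → m + n ≤ o → + m ℤ.≤ + o - + n
  m+n≤o⇒m≤o-n {m} {n} {o} m+n≤o = begin
    + m         ≡⟨ sym ([m+n]⊖n≡m m n) ⟩
    (m + n) ⊖ n ≤⟨ ℤ.⊖-monoˡ-≤ n m+n≤o ⟩
    o ⊖ n       ≡⟨ sym (ℤ.m-n≡m⊖n o n) ⟩
    + o - + n   ∎
    where open ℤ.≤-Reasoning

  m≤o+n⇒m-n≤o : ∀ {m n o} → m ≤ o + n → + m - + n ℤ.≤ + o
  m≤o+n⇒m-n≤o {m} {n} {o} m≤o+n = begin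
    + m - + n   ≡⟨ ℤ.m-n≡m⊖n m n ⟩
    m ⊖ n       ≤⟨ ℤ.⊖-monoˡ-≤ n m≤o+n ⟩
    (o + n) ⊖ n ≡⟨ [m+n]⊖n≡m o n ⟩
    + o         ∎
    where open ℤ.≤-Reasoning

  0<⇒≡suc[∸1] : ∀ {m} → 0 < m → m ≡ suc (m ∸ 1)
  0<⇒≡suc[∸1] 0<m = sym (m+[n∸m]≡n 0<m)

  suc[m+n]<o+p : ∀ {m n o p} → m < o → n < p → suc (m + n) < o + p
  suc[m+n]<o+p {m} {n} {o} {p} m<o n<p = subst (_≤ o + p) (cong suc (+-suc m n)) (+-mono-≤ m<o n<p)

  m≤n+o∧o<m⇒0<n : ∀ {m n o} → m ≤ n + o → o < m → 0 < n
  m≤n+o∧o<m⇒0<n {n = zero}  m≤o o<m = contradiction m≤o (<⇒≱ o<m)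
  m≤n+o∧o<m⇒0<n {n = suc n} _   _   = s≤s z≤n

  n≤2n : ∀ n → n ≤ 2 * n
  n≤2n n = m≤m+n n (n + 0)

  2n≡n+n : ∀ n → 2 * n ≡ n + n
  2n≡n+n n = cong (n ℕ.+_) (+-identityʳ n)

  2n+n≡3n : ∀ n → 2 * n + n ≡ 3 * n
  2n+n≡3n n = +-comm (2 * n) n

  InHex : ℕ → ℕ → ℕ → Set
  InHex n x y = x ≤ 2 * n × y ≤ 2 * n × n ≤ x + y × x + y ≤ 3 * n

  inHex⁻ : ∀ n x y → T (inHex n x y) → InHex n x y
  inHex⁻ _ _ _ h =
    let t₁ , h₁ = to T-∧ h
        t₂ , h₂ = to T-∧ h₁
        t₃ , t₄ = to T-∧ h₂
    in ≤ᵇ⇒≤ _ _ t₁ , ≤ᵇ⇒≤ _ _ t₂ , ≤ᵇ⇒≤ _ _ t₃ , ≤ᵇ⇒≤ _ _ t₄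

  inHex⁺ : ∀ n x y → InHex n x y → T (inHex n x y)
  inHex⁺ _ _ _ (p₁ , p₂ , p₃ , p₄) =
    from T-∧ (≤⇒≤ᵇ p₁ , from T-∧ (≤⇒≤ᵇ p₂ , from T-∧ (≤⇒≤ᵇ p₃ , ≤⇒≤ᵇ p₄)))

  record Black (n a b : ℕ) : Set where
    constructor mkBlack
    field
      a<2n   : a < 2 * n
      b<2n   : b < 2 * n
      n≤a+b  : n ≤ a + b
      a+b<3n : a + b < 3 * n

  record White (n c d : ℕ) : Set where
    constructor mkWhite
    field
      c<2n     : c < 2 * n
      d<2n     : d < 2 * n
      n≤1+c+d  : n ≤ suc (c + d)
      1+c+d<3n : suc (c + d) < 3 * n

  IsBlack IsWhite : ℕ → Tri → Set
  IsBlack n (a , b) = Black n a b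
  IsWhite n (c , d) = White n c d

  blackIn⁻ : T (blackIn n u) → IsBlack n u
  blackIn⁻ {n} {a , b} h =
    let h₁ , h₂₃ = to T-∧ h
        h₂ , h₃  = to T-∧ h₂₃
        _ , _ , n≤a+b , _     = inHex⁻ n a b h₁
        a<2n , _ , _ , a+b<3n = inHex⁻ n (suc a) b h₂
        _ , b<2n , _ , _      = inHex⁻ n a (suc b) h₃
    in mkBlack a<2n b<2n n≤a+b a+b<3n

  blackIn⁺ : IsBlack n u → T (blackIn n u)
  blackIn⁺ {n} {a , b} (mkBlack a<2n b<2n n≤a+b a+b<3n) =
    from T-∧ (inHex⁺ n a b (<⇒≤ a<2n , <⇒≤ b<2n , n≤a+b , <⇒≤ a+b<3n) ,
    from T-∧ (inHex⁺ n (suc a) b (a<2n , <⇒≤ b<2n , m≤n⇒m≤1+n n≤a+b , a+b<3n) ,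
              inHex⁺ n a (suc b) (<⇒≤ a<2n , b<2n , subst (n ≤_) 1+a+b≡ (m≤n⇒m≤1+n n≤a+b) ,
                                  subst (_≤ 3 * n) 1+a+b≡ a+b<3n)))
    where
    1+a+b≡ : suc (a + b) ≡ a + suc b
    1+a+b≡ = sym (+-suc a b)

  whiteIn⁻ : T (whiteIn n w) → IsWhite n w
  whiteIn⁻ {n} {c , d} h =
    let h₁ , h₂₃ = to T-∧ h
        h₂ , h₃  = to T-∧ h₂₃
        c<2n , _ , n≤1+c+d , _ = inHex⁻ n (suc c) d h₁
        _ , d<2n , _ , _       = inHex⁻ n c (suc d) h₂
        _ , _ , _ , 2+c+d≤3n   = inHex⁻ n (suc c) (suc d) h₃
    in mkWhite c<2n d<2n n≤1+c+d (subst (_≤ 3 * n) (cong suc (+-suc c d)) 2+c+d≤3n)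

  whiteIn⁺ : IsWhite n w → T (whiteIn n w)
  whiteIn⁺ {n} {c , d} (mkWhite c<2n d<2n n≤1+c+d 1+c+d<3n) =
    from T-∧ (inHex⁺ n (suc c) d (c<2n , <⇒≤ d<2n , n≤1+c+d , <⇒≤ 1+c+d<3n) ,
    from T-∧ (inHex⁺ n c (suc d) (<⇒≤ c<2n , d<2n , subst (n ≤_) 1+c+d≡ n≤1+c+d ,
                                  subst (_≤ 3 * n) 1+c+d≡ (<⇒≤ 1+c+d<3n)) ,
              inHex⁺ n (suc c) (suc d) (c<2n , d<2n , m≤n⇒m≤1+n (subst (n ≤_) 1+c+d≡ n≤1+c+d) ,
                                        subst (_≤ 3 * n) (cong suc 1+c+d≡) 1+c+d<3n)))
    where
    1+c+d≡ : suc (c + d) ≡ c + suc d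
    1+c+d≡ = sym (+-suc c d)

  -- The constructor says on which side of the black triangle the white one lies.
  data Adjacent : Tri → Tri → Set where
    right : ∀ {a b} → Adjacent (a , b) (a , b)
    left  : ∀ {c d} → Adjacent (suc c , d) (c , d)
    below : ∀ {c d} → Adjacent (c , suc d) (c , d)

  eqTri⁻ : ∀ {u v} → T (eqTri u v) → u ≡ v
  eqTri⁻ {a , b} {c , d} h = let p , q = to T-∧ h in cong₂ _,_ (≡ᵇ⇒≡ a c p) (≡ᵇ⇒≡ b d q)

  eqTri-refl : ∀ u → T (eqTri u u)
  eqTri-refl (a , b) = from T-∧ (≡⇒≡ᵇ a a refl , ≡⇒≡ᵇ b b refl)

  adjacent⁻ : T (adjacent u w) → Adjacent u w
  adjacent⁻ {a , b} {c , d} h with to T-∨ h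
  ... | inj₁ e with refl ← eqTri⁻ {a , b} {c , d} e = right
  ... | inj₂ h′ with to T-∨ h′
  ...   | inj₁ e with refl ← eqTri⁻ {a , b} {suc c , d} e = left
  ...   | inj₂ e with refl ← eqTri⁻ {a , b} {c , suc d} e = below

  adjacent⁺ : Adjacent u w → T (adjacent u w)
  adjacent⁺ {u} {c , d} right = from (T-∨ {eqTri u (c , d)}) (inj₁ (eqTri-refl u))
  adjacent⁺ {u} {c , d} left  =
    from (T-∨ {eqTri u (c , d)}) (inj₂ (from (T-∨ {eqTri u (suc c , d)}) (inj₁ (eqTri-refl u))))
  adjacent⁺ {u} {c , d} below =
    from (T-∨ {eqTri u (c , d)}) (inj₂ (from (T-∨ {eqTri u (suc c , d)}) (inj₂ (eqTri-refl u))))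

  _<ₗₑₓ_ : Rel Tri 0ℓ
  _<ₗₑₓ_ = ×-Lex _≡_ _<_ _<_

  <ₗₑₓ-asym : Asymmetric _<ₗₑₓ_
  <ₗₑₓ-asym = ×-asymmetric {_<₁_ = _<_} {_<₂_ = _<_} sym (resp₂ _<_) <-asym <-asym

  <ₗₑₓ⇒≢ : ∀ {u v} → u <ₗₑₓ v → u ≢ v
  <ₗₑₓ⇒≢ u<v refl = <ₗₑₓ-asym u<v u<v

  adjacent⇒≤ₗₑₓ : Adjacent u w → w ≡ u ⊎ w <ₗₑₓ u
  adjacent⇒≤ₗₑₓ right = inj₁ refl
  adjacent⇒≤ₗₑₓ left  = inj₂ (inj₁ ≤-refl)
  adjacent⇒≤ₗₑₓ below = inj₂ (inj₂ (refl , ≤-refl))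

  module Cells (p : Tri → Bool) (n : ℕ) where

    coordinates : List ℕ
    coordinates = upTo (suc (2 * n))

    cells≡ : filterᵇ p (grid n) ≡ filter (T? ∘ p) (cartesianProduct coordinates coordinates)
    cells≡ = trans (filterᵇ≡filter p (grid n))
                   (cong (filter (T? ∘ p)) (concatMap-pairs≡cartesianProduct coordinates coordinates))

    ∈-cells⁻ : u ∈ filterᵇ p (grid n) → T (p u)
    ∈-cells⁻ u∈ = proj₂ (∈-filter⁻ (T? ∘ p) (subst (_ ∈_) cells≡ u∈))

    ∈-cells⁺ : ∀ {a b} → a ≤ 2 * n → b ≤ 2 * n → T (p (a , b)) → (a , b) ∈ filterᵇ p (grid n)
    ∈-cells⁺ a≤2n b≤2n t = subst (_ ∈_) (sym cells≡)
      (∈-filter⁺ (T? ∘ p) (∈-cartesianProduct⁺ (∈-upTo⁺ (s≤s a≤2n)) (∈-upTo⁺ (s≤s b≤2n))) t)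

    cells-sorted : AllPairs _<ₗₑₓ_ (filterᵇ p (grid n))
    cells-sorted = subst (AllPairs _<ₗₑₓ_) (sym cells≡)
      (AllPairs.filter⁺ (T? ∘ p) (cartesianProduct-sorted coordinates-sorted coordinates-sorted))
      where
      coordinates-sorted : AllPairs _<_ coordinates
      coordinates-sorted = upTo-sorted (suc (2 * n))

  ∈-blacks⁻ : u ∈ blacks n → IsBlack n u
  ∈-blacks⁻ {n = n} = blackIn⁻ ∘ Cells.∈-cells⁻ (blackIn n) n

  ∈-blacks⁺ : IsBlack n u → u ∈ blacks n
  ∈-blacks⁺ {n} {a , b} β =
    Cells.∈-cells⁺ (blackIn n) n (<⇒≤ (Black.a<2n β)) (<⇒≤ (Black.b<2n β)) (blackIn⁺ β)

  ∈-whites⁻ : w ∈ whites n → IsWhite n w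
  ∈-whites⁻ {n = n} = whiteIn⁻ ∘ Cells.∈-cells⁻ (whiteIn n) n

  ∈-whites⁺ : IsWhite n w → w ∈ whites n
  ∈-whites⁺ {n} {c , d} ω =
    Cells.∈-cells⁺ (whiteIn n) n (<⇒≤ (White.c<2n ω)) (<⇒≤ (White.d<2n ω)) (whiteIn⁺ ω)

  blacks-sorted : ∀ n → AllPairs _<ₗₑₓ_ (blacks n)
  blacks-sorted n = Cells.cells-sorted (blackIn n) n

  blacks-unique : ∀ n → Unique (blacks n)
  blacks-unique n = AllPairs.map <ₗₑₓ⇒≢ (blacks-sorted n)

  whites-unique : ∀ n → Unique (whites n)
  whites-unique n = AllPairs.map <ₗₑₓ⇒≢ (Cells.cells-sorted (whiteIn n) n)

  Neighbour : ℕ → List Tri → Tri → Set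
  Neighbour n U w = IsWhite n w × ∃[ u ] u ∈ U × Adjacent u w

  nbhd≡filter : ∀ n U → nbhd n U ≡ filter (T? ∘ λ w → any (λ u → adjacent u w) U) (whites n)
  nbhd≡filter n U = filterᵇ≡filter _ (whites n)

  ∈-nbhd⁻ : ∀ n U → w ∈ nbhd n U → Neighbour n U w
  ∈-nbhd⁻ {w} n U w∈ =
    let w∈whites , t = ∈-filter⁻ (T? ∘ λ w → any (λ u → adjacent u w) U)
                                 (subst (w ∈_) (nbhd≡filter n U) w∈)
        u , u∈U , adj = find (any⁻ (λ u → adjacent u w) U t)
    in ∈-whites⁻ w∈whites , u , u∈U , adjacent⁻ adj

  ∈-nbhd⁺ : ∀ n U → Neighbour n U w → w ∈ nbhd n U
  ∈-nbhd⁺ {w} n U (ω , u , u∈U , adj) = subst (w ∈_) (sym (nbhd≡filter n U))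
    (∈-filter⁺ (T? ∘ λ w → any (λ u → adjacent u w) U) (∈-whites⁺ ω)
               (any⁺ (λ u → adjacent u w) (lose u∈U (adjacent⁺ adj))))

  nbhd-unique : ∀ n U → Unique (nbhd n U)
  nbhd-unique n U = subst Unique (sym (nbhd≡filter n U))
    (AllPairs.filter⁺ (T? ∘ λ w → any (λ u → adjacent u w) U) (whites-unique n))

  ≤-excess : ∀ n U → length U + n ≤ length (nbhd n U) → + n ℤ.≤ excess n U
  ≤-excess n U bound = m+n≤o⇒m≤o-n (subst (_≤ length (nbhd n U)) (+-comm (length U) n) bound)

  excess-≤ : ∀ n U → length (nbhd n U) ≤ n + length U → excess n U ℤ.≤ + n
  excess-≤ n U = m≤o+n⇒m-n≤o

  ∈-prefixExcesses : ∀ n σ {k} → k < length σ → excess n (take (suc k) σ) ∈ prefixExcesses n σ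
  ∈-prefixExcesses n σ k<len = ∈-map⁺ (λ k → excess n (take (suc k) σ)) (∈-upTo⁺ k<len)

  prefixExcesses-≤ : ∀ n σ {c} → (∀ k → excess n (take (suc k) σ) ℤ.≤ c) →
                     All (ℤ._≤ c) (prefixExcesses n σ)
  prefixExcesses-≤ n σ bound = All.map⁺ (All.tabulate λ {k} _ → bound k)

  maxExcess-≤ : ∀ n σ {c} → + 0 ℤ.≤ c → All (ℤ._≤ c) (prefixExcesses n σ) → maxExcess n σ ℤ.≤ c
  maxExcess-≤ n σ 0≤c es≤c with prefixExcesses n σ
  maxExcess-≤ n σ 0≤c []           | []     = 0≤c
  maxExcess-≤ n σ 0≤c (e≤c ∷ es≤c) | e ∷ es = foldr-preservesᵇ ℤ.⊔-lub e≤c es≤c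

  ≤-maxExcess : ∀ n σ {z} → z ∈ prefixExcesses n σ → z ℤ.≤ maxExcess n σ
  ≤-maxExcess n σ z∈ with prefixExcesses n σ
  ... | e ∷ es = ≤-foldr-⊔ e es z∈

  -- The lexicographic ordering

  bottomEdge : ℕ → List Tri
  bottomEdge n = map (λ c → c , n ∸ suc c) (upTo n)

  bottomEdge-length : ∀ n → length (bottomEdge n) ≡ n
  bottomEdge-length n = trans (length-map _ (upTo n)) (length-upTo n)

  white⇒black⊎bottomEdge : ∀ {c d} → White n c d → Black n c d ⊎ (c , d) ∈ bottomEdge n
  white⇒black⊎bottomEdge {n} {c} {d} (mkWhite c<2n d<2n n≤1+c+d 1+c+d<3n) with n ≤? c + d
  ... | yes n≤c+d = inj₁ (mkBlack c<2n d<2n n≤c+d (<⇒≤ 1+c+d<3n))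
  ... | no n≰c+d  =
    inj₂ (subst (λ e → (c , e) ∈ bottomEdge n) n∸1+c≡d (∈-map⁺ (λ c → c , n ∸ suc c) (∈-upTo⁺ c<n)))
    where
    1+c+d≡n : suc (c + d) ≡ n
    1+c+d≡n = ≤-antisym (≰⇒> n≰c+d) n≤1+c+d
    c<n : c < n
    c<n = subst (c <_) 1+c+d≡n (s≤s (m≤m+n c d))
    n∸1+c≡d : n ∸ suc c ≡ d
    n∸1+c≡d = subst (λ m → m ∸ suc c ≡ d) 1+c+d≡n (m+n∸m≡n (suc c) d)

  nbhd-lexPrefix-⊆ : ∀ n k → nbhd n (take k (blacks n)) ⊆ take k (blacks n) ++ bottomEdge n
  nbhd-lexPrefix-⊆ n k {_ , _} w∈ with ω , u , u∈prefix , adj ← ∈-nbhd⁻ n (take k (blacks n)) w∈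
    with white⇒black⊎bottomEdge ω | adjacent⇒≤ₗₑₓ adj
  ... | inj₂ w∈edge | _         = ∈-++⁺ʳ (take k (blacks n)) w∈edge
  ... | inj₁ _      | inj₁ refl = ∈-++⁺ˡ u∈prefix
  ... | inj₁ β      | inj₂ w<u  =
    ∈-++⁺ˡ (take-lowerClosed <ₗₑₓ-asym (blacks-sorted n) u∈prefix (∈-blacks⁺ β) w<u)

  lexPrefix-excess-≤ : ∀ n k → excess n (take k (blacks n)) ℤ.≤ + n
  lexPrefix-excess-≤ n k = excess-≤ n U (begin
    length (nbhd n U)                ≤⟨ length-≤-⊆ (nbhd-unique n U) (nbhd-lexPrefix-⊆ n k) ⟩
    length (U ++ bottomEdge n)       ≡⟨ length-++ U ⟩
    length U + length (bottomEdge n) ≡⟨ cong (length U ℕ.+_) (bottomEdge-length n) ⟩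
    length U + n                     ≡⟨ +-comm (length U) n ⟩
    n + length U                     ∎)
    where
    open ≤-Reasoning
    U : List Tri
    U = take k (blacks n)

  lexOrder-maxExcess-≤ : ∀ n → maxExcess n (blacks n) ℤ.≤ + n
  lexOrder-maxExcess-≤ n =
    maxExcess-≤ n (blacks n) (ℤ.+≤+ z≤n)
                (prefixExcesses-≤ n (blacks n) (λ k → lexPrefix-excess-≤ n (suc k)))

  -- Lines of black triangles

  -- A direction arranges the black triangles in parallel lines, each with a position on its line;
  -- the slot (l , p) is the white triangle on line l between positions p and p + 1.  A line is
  -- white-ended when there are white triangles beyond both of its end black triangles.
  record Direction (n : ℕ) : Set₁ where
    field
      line pos   : Tri → ℕ
      slot       : Tri → ℕ × ℕ
      WhiteEnded : ℕ → Set
      whiteEnded? : Decidable WhiteEnded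
      line-pos-injective : ∀ {u v} → line u ≡ line v → pos u ≡ pos v → u ≡ v
      whiteEnded⇒0<pos : ∀ {u} → IsBlack n u → WhiteEnded (line u) → 0 < pos u
      left-white : ∀ {u} → IsBlack n u → 0 < pos u →
                   ∃[ w ] IsWhite n w × Adjacent u w × slot w ≡ (line u , pos u ∸ 1)
      right-white : ∀ {u} → IsBlack n u →
                    WhiteEnded (line u) ⊎ (∃[ v ] IsBlack n v × line v ≡ line u × pos u < pos v) →
                    ∃[ w ] IsWhite n w × Adjacent u w × slot w ≡ (line u , pos u)

  module LineCounting {n : ℕ} (D : Direction n) where
    open Direction D

    RightGap : List Tri → Tri → Set
    RightGap U u = Any (λ v → line v ≡ line u × pos u < pos v × v ∉ U) (blacks n)

    rightGap? : ∀ U → Decidable (RightGap U)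
    rightGap? U u = any? (λ v → line v ≟ line u ×-dec pos u <? pos v ×-dec ¬? (v ∈? U)) (blacks n)

    -- The white neighbour of u is taken on its line towards a black triangle missing from U: to
    -- the right if there is one to the right, otherwise to the left.  On a white-ended line it is
    -- always taken to the left, which leaves the slot right of the topmost element of U free.
    slotIndex : List Tri → Tri → ℕ
    slotIndex U u with whiteEnded? (line u) | rightGap? U u
    ... | no _ | yes _ = pos u
    ... | _    | _     = pos u ∸ 1

    slotOf : List Tri → Tri → ℕ × ℕ
    slotOf U u = line u , slotIndex U u

    topPos : List Tri → ℕ → ℕ
    topPos U l = max 0 (map pos (filter (λ v → line v ≟ l) U))

    topSlot : List Tri → ℕ → ℕ × ℕ
    topSlot U l = l , topPos U l

    pos≤topPos : ∀ {U u} → u ∈ U → pos u ≤ topPos U (line u)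
    pos≤topPos {U} {u} u∈U =
      All.lookup (xs≤max 0 _) (∈-map⁺ pos (∈-filter⁺ (λ v → line v ≟ line u) u∈U refl))

    topPos-attained : ∀ {U u} → u ∈ U → ∃[ t ] t ∈ U × line t ≡ line u × pos t ≡ topPos U (line u)
    topPos-attained {U} {u} u∈U with argmax-sel id 0 (map pos (filter (λ v → line v ≟ line u) U))
    ... | inj₁ top≡0 =
      u , u∈U , refl , trans (n≤0⇒n≡0 (subst (pos u ≤_) top≡0 (pos≤topPos u∈U))) (sym top≡0)
    ... | inj₂ top∈ with t , t∈filter , top≡pos-t ← ∈-map⁻ pos top∈ =
      let t∈U , line-t = ∈-filter⁻ (λ v → line v ≟ line u) t∈filter in t , t∈U , line-t , sym top≡pos-t

    data SlotCase (U : List Tri) (u : Tri) : ℕ → Set where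
      leftward  : ∀ {q} → pos u ≡ suc q → WhiteEnded (line u) ⊎ ¬ RightGap U u → SlotCase U u q
      rightward : ¬ WhiteEnded (line u) → RightGap U u → SlotCase U u (pos u)

    rightGap-shift : ∀ {U u u′} → u′ ∈ U → line u ≡ line u′ → pos u′ ≡ suc (pos u) →
                     RightGap U u → RightGap U u′
    rightGap-shift {U} {u} {u′} u′∈U same pos≡ gap
      with v , v∈blacks , line-v , pos-u<pos-v , v∉U ← find gap =
      lose v∈blacks (trans line-v same , pos-u′<pos-v , v∉U)
      where
      pos-u′≢pos-v : pos u′ ≢ pos v
      pos-u′≢pos-v eq = v∉U (subst (_∈ U) (line-pos-injective (sym (trans line-v same)) eq) u′∈U)
      pos-u′<pos-v : pos u′ < pos v
      pos-u′<pos-v = ≤∧≢⇒< (subst (_≤ pos v) (sym pos≡) pos-u<pos-v) pos-u′≢pos-v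

    module _ {U : List Tri} (U-black : All (IsBlack n) U)
             (gap : ∀ {u} → u ∈ U → ¬ WhiteEnded (line u) →
                    ∃[ v ] IsBlack n v × line v ≡ line u × v ∉ U) where

      slotCase : ∀ {u} → u ∈ U → SlotCase U u (slotIndex U u)
      slotCase {u} u∈U with whiteEnded? (line u) | rightGap? U u
      ... | no ¬we | yes rg = rightward ¬we rg
      ... | yes we | _      =
        leftward (0<⇒≡suc[∸1] (whiteEnded⇒0<pos (All.lookup U-black u∈U) we)) (inj₁ we)
      ... | no ¬we | no ¬rg = leftward (0<⇒≡suc[∸1] 0<pos) (inj₂ ¬rg)
        where
        0<pos : 0 < pos u
        0<pos with v , β , line-v , v∉U ← gap u∈U ¬we = ≤-<-trans z≤n pos-v<pos-u
          where
          pos-v≢pos-u : pos v ≢ pos u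
          pos-v≢pos-u eq = v∉U (subst (_∈ U) (sym (line-pos-injective line-v eq)) u∈U)
          pos-v<pos-u : pos v < pos u
          pos-v<pos-u = ≤∧≢⇒< (≮⇒≥ λ pos-u<pos-v → ¬rg (lose (∈-blacks⁺ β) (line-v , pos-u<pos-v , v∉U)))
                              pos-v≢pos-u

      same-slotIndex⇒same-pos : ∀ {u u′ q q′} → u ∈ U → u′ ∈ U → SlotCase U u q → SlotCase U u′ q′ →
                                line u ≡ line u′ → q ≡ q′ → pos u ≡ pos u′
      same-slotIndex⇒same-pos _ _ (leftward p _) (leftward p′ _) _ refl = trans p (sym p′)
      same-slotIndex⇒same-pos _ _ (rightward _ _) (rightward _ _) _ q≡q′ = q≡q′
      same-slotIndex⇒same-pos _ _ (rightward ¬we _) (leftward _ (inj₁ we′)) same _ =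
        contradiction (subst WhiteEnded (sym same) we′) ¬we
      same-slotIndex⇒same-pos _ u′∈U (rightward _ rg) (leftward p′ (inj₂ ¬rg′)) same refl =
        contradiction (rightGap-shift u′∈U same p′ rg) ¬rg′
      same-slotIndex⇒same-pos _ _ (leftward _ (inj₁ we)) (rightward ¬we′ _) same _ =
        contradiction (subst WhiteEnded same we) ¬we′
      same-slotIndex⇒same-pos u∈U _ (leftward p (inj₂ ¬rg)) (rightward _ rg′) same refl =
        contradiction (rightGap-shift u∈U (sym same) p rg′) ¬rg

      slotOf-injective : ∀ {u u′} → u ∈ U → u′ ∈ U → slotOf U u ≡ slotOf U u′ → u ≡ u′
      slotOf-injective {u} {u′} u∈U u′∈U eq = line-pos-injective same-line
        (same-slotIndex⇒same-pos u∈U u′∈U (slotCase u∈U) (slotCase u′∈U) same-line (cong proj₂ eq))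
        where
        same-line : line u ≡ line u′
        same-line = cong proj₁ eq

      slotCase-below-top : ∀ {u q} → u ∈ U → SlotCase U u q → WhiteEnded (line u) → q ≢ topPos U (line u)
      slotCase-below-top u∈U (leftward p _) _ refl =
        <-irrefl refl (subst (_≤ topPos U _) p (pos≤topPos u∈U))
      slotCase-below-top _ (rightward ¬we _) we _ = ¬we we

      slotOf-white : ∀ {u} → u ∈ U → ∃[ w ] w ∈ nbhd n U × slot w ≡ slotOf U u
      slotOf-white {u} u∈U = white-at (slotCase u∈U)
        where
        β : IsBlack n u
        β = All.lookup U-black u∈U
        white-at : ∀ {q} → SlotCase U u q → ∃[ w ] w ∈ nbhd n U × slot w ≡ (line u , q)
        white-at (leftward p _)
          with w , ω , adj , slot-w ← left-white β (subst (0 <_) (sym p) (s≤s z≤n)) =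
          w , ∈-nbhd⁺ n U (ω , u , u∈U , adj) , trans slot-w (cong (line u ,_) (cong (_∸ 1) p))
        white-at (rightward _ rg) with v , v∈blacks , line-v , pos-u<pos-v , _ ← find rg
          with w , ω , adj , slot-w ← right-white β (inj₂ (v , ∈-blacks⁻ v∈blacks , line-v , pos-u<pos-v)) =
          w , ∈-nbhd⁺ n U (ω , u , u∈U , adj) , slot-w

      topSlot-white : ∀ {u} → u ∈ U → WhiteEnded (line u) →
                      ∃[ w ] w ∈ nbhd n U × slot w ≡ topSlot U (line u)
      topSlot-white u∈U we with t , t∈U , line-t , pos-t ← topPos-attained u∈U
        with w , ω , adj , slot-w ←
               right-white (All.lookup U-black t∈U) (inj₁ (subst WhiteEnded (sym line-t) we)) =
        w , ∈-nbhd⁺ n U (ω , t , t∈U , adj) , trans slot-w (cong₂ _,_ line-t pos-t)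

      length-nbhd-≥ : Unique U → ∀ ls → Unique ls →
                      (∀ {l} → l ∈ ls → WhiteEnded l × ∃[ u ] u ∈ U × line u ≡ l) →
                      length U + length ls ≤ length (nbhd n U)
      length-nbhd-≥ U-unique ls ls-unique ls-met = begin
        length U + length ls
          ≡⟨ sym (cong₂ _+_ (length-map (slotOf U) U) (length-map (topSlot U) ls)) ⟩
        length (map (slotOf U) U) + length (map (topSlot U) ls)
          ≡⟨ sym (length-++ (map (slotOf U) U)) ⟩
        length (map (slotOf U) U ++ map (topSlot U) ls)
          ≤⟨ length-≤-⊆ slots-unique slots-⊆ ⟩
        length (map slot (nbhd n U))
          ≡⟨ length-map slot (nbhd n U) ⟩
        length (nbhd n U) ∎
        where
        open ≤-Reasoning

        disjoint : ∀ {s} → s ∈ map (slotOf U) U × s ∈ map (topSlot U) ls → ⊥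
        disjoint (s∈slots , s∈tops) with u , u∈U , refl ← ∈-map⁻ (slotOf U) s∈slots
                                      | l , l∈ls , eq ← ∈-map⁻ (topSlot U) s∈tops
                                      with refl ← cong proj₁ eq =
          slotCase-below-top u∈U (slotCase u∈U) (proj₁ (ls-met l∈ls)) (cong proj₂ eq)

        slots-unique : Unique (map (slotOf U) U ++ map (topSlot U) ls)
        slots-unique =
          Unique.++⁺ (Unique-map⁺ U-unique slotOf-injective) (Unique.map⁺ (cong proj₁) ls-unique) disjoint

        slots-⊆ : map (slotOf U) U ++ map (topSlot U) ls ⊆ map slot (nbhd n U)
        slots-⊆ s∈ with ∈-++⁻ (map (slotOf U) U) s∈
        ... | inj₁ s∈slots with u , u∈U , refl ← ∈-map⁻ (slotOf U) s∈slots =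
          ∈-map-witness (slotOf-white u∈U)
        ... | inj₂ s∈tops with l , l∈ls , refl ← ∈-map⁻ (topSlot U) s∈tops
                          with we , u , u∈U , refl ← ls-met l∈ls = ∈-map-witness (topSlot-white u∈U we)

  -- The three directions

  white-left : ∀ {a b} → Black n (suc a) b → White n a b
  white-left (mkBlack 1+a<2n b<2n n≤1+a+b 1+a+b<3n) = mkWhite (<⇒≤ 1+a<2n) b<2n n≤1+a+b 1+a+b<3n

  white-below : ∀ {a b} → Black n a (suc b) → White n a b
  white-below {n} {a} {b} (mkBlack a<2n 1+b<2n n≤a+1+b a+1+b<3n) =
    mkWhite a<2n (<⇒≤ 1+b<2n) (subst (n ≤_) (+-suc a b) n≤a+1+b) (subst (_< 3 * n) (+-suc a b) a+1+b<3n)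

  white-right : ∀ {a b} → Black n a b → suc (a + b) < 3 * n → White n a b
  white-right (mkBlack a<2n b<2n n≤a+b _) 1+a+b<3n = mkWhite a<2n b<2n (m≤n⇒m≤1+n n≤a+b) 1+a+b<3n

  black-swap : ∀ {a b} → Black n a b → Black n b a
  black-swap {n} {a} {b} (mkBlack a<2n b<2n n≤a+b a+b<3n) =
    mkBlack b<2n a<2n (subst (n ≤_) (+-comm a b) n≤a+b) (subst (_< 3 * n) (+-comm a b) a+b<3n)

  rows : ∀ n → Direction n
  rows n = record
    { line = proj₂ ; pos = proj₁ ; slot = swap
    ; WhiteEnded = _< n ; whiteEnded? = _<? n
    ; line-pos-injective = λ line≡ pos≡ → ×-≡,≡→≡ (pos≡ , line≡)
    ; whiteEnded⇒0<pos = λ { {a , b} β → m≤n+o∧o<m⇒0<n (Black.n≤a+b β) }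
    ; left-white = λ
        { {zero  , b} _ ()
        ; {suc a , b} β _ → (a , b) , white-left β , left , refl
        }
    ; right-white = λ
        { {a , b} β (inj₁ b<n) →
            (a , b) , white-right β (subst (suc (a + b) <_) (2n+n≡3n n) (suc[m+n]<o+p (Black.a<2n β) b<n)) ,
            right , refl
        ; {a , b} β (inj₂ ((a′ , .b) , β′ , refl , a<a′)) →
            (a , b) , white-right β (≤-<-trans (+-monoˡ-≤ b a<a′) (Black.a+b<3n β′)) , right , refl
        }
    }

  columns : ∀ n → Direction n
  columns n = record
    { line = proj₁ ; pos = proj₂ ; slot = id
    ; WhiteEnded = _< n ; whiteEnded? = _<? n
    ; line-pos-injective = λ line≡ pos≡ → ×-≡,≡→≡ (line≡ , pos≡)
    ; whiteEnded⇒0<pos = λ { {a , b} β → m≤n+o∧o<m⇒0<n (Black.n≤a+b (black-swap β)) }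
    ; left-white = λ
        { {a , zero } _ ()
        ; {a , suc b} β _ → (a , b) , white-below β , below , refl
        }
    ; right-white = λ
        { {a , b} β (inj₁ a<n) → (a , b) , white-right β (suc[m+n]<o+p a<n (Black.b<2n β)) , right , refl
        ; {a , b} β (inj₂ ((.a , b′) , β′ , refl , b<b′)) →
            (a , b) , white-right β (≤-<-trans (subst (_≤ a + b′) (+-suc a b) (+-monoʳ-≤ a b<b′)) (Black.a+b<3n β′))
            , right , refl
        }
    }

  diagonals : ∀ n → Direction n
  diagonals n = record
    { line = λ (a , b) → a + b ; pos = proj₁ ; slot = λ (c , d) → suc (c + d) , c
    ; WhiteEnded = 2 * n ≤_ ; whiteEnded? = 2 * n ≤?_
    ; line-pos-injective = λ { {a , b} {.a , b′} sum≡ refl → cong (a ,_) (+-cancelˡ-≡ a b b′ sum≡) }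
    ; whiteEnded⇒0<pos = λ { {a , b} β 2n≤a+b → m≤n+o∧o<m⇒0<n 2n≤a+b (Black.b<2n β) }
    ; left-white = λ
        { {zero  , b} _ ()
        ; {suc a , b} β _ → (a , b) , white-left β , left , refl
        }
    ; right-white = λ
        { {a , suc b} β _ → (a , b) , white-below β , below , cong (_, a) (sym (+-suc a b))
        ; {a , zero} β (inj₁ 2n≤a+0) →
            contradiction (subst (2 * n ≤_) (+-identityʳ a) 2n≤a+0) (<⇒≱ (Black.a<2n β))
        ; {a , zero} β (inj₂ ((a′ , b′) , _ , sum≡ , a<a′)) →
            contradiction (≤-trans (m≤m+n a′ b′) (≤-reflexive (trans sum≡ (+-identityʳ a)))) (<⇒≱ a<a′)
        }
    }

  data Axis : Set where
    row column diagonal : Axis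

  axes : List Axis
  axes = row ∷ column ∷ diagonal ∷ []

  ∈-axes : ∀ d → d ∈ axes
  ∈-axes row      = here refl
  ∈-axes column   = there (here refl)
  ∈-axes diagonal = there (there (here refl))

  direction : ∀ n → Axis → Direction n
  direction n row      = rows n
  direction n column   = columns n
  direction n diagonal = diagonals n

  lineOf : ℕ → Axis → Tri → ℕ
  lineOf n d = Direction.line (direction n d)

  WhiteEndedOf : ℕ → Axis → ℕ → Set
  WhiteEndedOf n d = Direction.WhiteEnded (direction n d)

  whiteEndedLines : ℕ → Axis → List ℕ
  whiteEndedLines n row      = upTo n
  whiteEndedLines n column   = upTo n
  whiteEndedLines n diagonal = map (2 * n ℕ.+_) (upTo n)

  whiteEndedLines-length : ∀ n d → length (whiteEndedLines n d) ≡ n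
  whiteEndedLines-length n row      = length-upTo n
  whiteEndedLines-length n column   = length-upTo n
  whiteEndedLines-length n diagonal = trans (length-map (2 * n ℕ.+_) (upTo n)) (length-upTo n)

  whiteEndedLines-unique : ∀ n d → Unique (whiteEndedLines n d)
  whiteEndedLines-unique n row      = Unique.upTo⁺ n
  whiteEndedLines-unique n column   = Unique.upTo⁺ n
  whiteEndedLines-unique n diagonal = Unique.map⁺ (+-cancelˡ-≡ (2 * n) _ _) (Unique.upTo⁺ n)

  ∈-diagonalLines⁻ : ∀ {l} → l ∈ map (2 * n ℕ.+_) (upTo n) → ∃[ i ] i < n × l ≡ 2 * n + i
  ∈-diagonalLines⁻ l∈ with i , i∈ , l≡ ← ∈-map⁻ _ l∈ = i , ∈-upTo⁻ i∈ , l≡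

  ∈-whiteEndedLines⇒WhiteEnded : ∀ n d {l} → l ∈ whiteEndedLines n d → WhiteEndedOf n d l
  ∈-whiteEndedLines⇒WhiteEnded n row      l∈ = ∈-upTo⁻ l∈
  ∈-whiteEndedLines⇒WhiteEnded n column   l∈ = ∈-upTo⁻ l∈
  ∈-whiteEndedLines⇒WhiteEnded n diagonal l∈ with i , _ , refl ← ∈-diagonalLines⁻ l∈ = m≤m+n (2 * n) i

  row-meets-column : ∀ {a b} → n ≤ b → b < 2 * n → a < n → Black n a b
  row-meets-column {n} {a} {b} n≤b b<2n a<n =
    mkBlack (<-≤-trans a<n (n≤2n n)) b<2n (≤-trans n≤b (m≤n+m b a)) (+-mono-< a<n b<2n)

  row-meets-diagonal : ∀ {b i k} → n ≤ b → b < 2 * n → i < n → k + b ≡ 2 * n + i → Black n k b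
  row-meets-diagonal {n} {b} {i} {k} n≤b b<2n i<n k+b≡ = mkBlack k<2n b<2n n≤k+b k+b<3n
    where
    k<2n : k < 2 * n
    k<2n = +-cancelʳ-< b k (2 * n) (begin-strict
      k + b     ≡⟨ k+b≡ ⟩
      2 * n + i <⟨ +-monoʳ-< (2 * n) (<-≤-trans i<n n≤b) ⟩
      2 * n + b ∎)
      where open ≤-Reasoning
    n≤k+b : n ≤ k + b
    n≤k+b = ≤-trans (≤-trans (n≤2n n) (m≤m+n (2 * n) i)) (≤-reflexive (sym k+b≡))
    k+b<3n : k + b < 3 * n
    k+b<3n = subst (_< 3 * n) (sym k+b≡) (subst (2 * n + i <_) (2n+n≡3n n) (+-monoʳ-< (2 * n) i<n))

  diagonal-meets-row : ∀ {s l k} → n ≤ s → s < 2 * n → l < n → k + l ≡ s → Black n k l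
  diagonal-meets-row {n} {s} {l} {k} n≤s s<2n l<n k+l≡s =
    mkBlack (≤-<-trans (≤-trans (m≤m+n k l) (≤-reflexive k+l≡s)) s<2n) (<-≤-trans l<n (n≤2n n))
            (subst (n ≤_) (sym k+l≡s) n≤s) (subst (_< 3 * n) (sym k+l≡s) (<-≤-trans s<2n (m≤n+m (2 * n) n)))

  Crossing : ℕ → Axis → Axis → Tri → Set
  Crossing n d₀ d x =
    ∀ {l} → l ∈ whiteEndedLines n d → ∃[ w ] IsBlack n w × lineOf n d₀ w ≡ lineOf n d₀ x × lineOf n d w ≡ l

  CrossingAxis : ℕ → Axis → Tri → Set
  CrossingAxis n d₀ x = ∃[ d ] WhiteEndedOf n d (lineOf n d x) × Crossing n d₀ d x

  crossing-from-row : ∀ {a b} → Black n a b → n ≤ b → CrossingAxis n row (a , b)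
  crossing-from-row {n} {a} {b} β n≤b with a <? n
  ... | yes a<n = column , a<n , λ l∈ → (_ , b) , row-meets-column n≤b (Black.b<2n β) (∈-upTo⁻ l∈) , refl , refl
  ... | no a≮n  = diagonal , subst (_≤ a + b) (sym (2n≡n+n n)) (+-mono-≤ (≮⇒≥ a≮n) n≤b) , meet
    where
    meet : Crossing n row diagonal (a , b)
    meet l∈ with i , i<n , refl ← ∈-diagonalLines⁻ l∈ =
      (2 * n + i ∸ b , b) , row-meets-diagonal n≤b (Black.b<2n β) i<n (m∸n+n≡m b≤l) , refl , m∸n+n≡m b≤l
      where
      b≤l : b ≤ 2 * n + i
      b≤l = ≤-trans (<⇒≤ (Black.b<2n β)) (m≤m+n (2 * n) i)

  crossing-from-column : ∀ {a b} → Black n a b → n ≤ a → CrossingAxis n column (a , b)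
  crossing-from-column {n} {a} {b} β n≤a with b <? n
  ... | yes b<n = row , b<n , λ l∈ →
    (a , _) , black-swap (row-meets-column n≤a (Black.a<2n β) (∈-upTo⁻ l∈)) , refl , refl
  ... | no b≮n  = diagonal , subst (_≤ a + b) (sym (2n≡n+n n)) (+-mono-≤ n≤a (≮⇒≥ b≮n)) , meet
    where
    meet : Crossing n column diagonal (a , b)
    meet l∈ with i , i<n , refl ← ∈-diagonalLines⁻ l∈ =
      (a , 2 * n + i ∸ a) , black-swap (row-meets-diagonal n≤a (Black.a<2n β) i<n (m∸n+n≡m a≤l)) ,
      refl , m+[n∸m]≡n a≤l
      where
      a≤l : a ≤ 2 * n + i
      a≤l = ≤-trans (<⇒≤ (Black.a<2n β)) (m≤m+n (2 * n) i)

  crossing-from-diagonal : ∀ {a b} → Black n a b → a + b < 2 * n → CrossingAxis n diagonal (a , b)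
  crossing-from-diagonal {n} {a} {b} β s<2n with b <? n
  ... | yes b<n = row , b<n , λ {l} l∈ → let l≤s = l≤s (∈-upTo⁻ l∈) in
      (a + b ∸ l , l) , diagonal-meets-row n≤s s<2n (∈-upTo⁻ l∈) (m∸n+n≡m l≤s) , m∸n+n≡m l≤s , refl
    where
    n≤s : n ≤ a + b
    n≤s = Black.n≤a+b β
    l≤s : ∀ {l} → l < n → l ≤ a + b
    l≤s l<n = <⇒≤ (<-≤-trans l<n n≤s)
  ... | no b≮n = column , a<n , λ {l} l∈ → let l≤s = l≤s (∈-upTo⁻ l∈) in
      (l , a + b ∸ l) , black-swap (diagonal-meets-row n≤s s<2n (∈-upTo⁻ l∈) (m∸n+n≡m l≤s)) ,
      m+[n∸m]≡n l≤s , refl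
    where
    n≤s : n ≤ a + b
    n≤s = Black.n≤a+b β
    l≤s : ∀ {l} → l < n → l ≤ a + b
    l≤s l<n = <⇒≤ (<-≤-trans l<n n≤s)
    a<n : a < n
    a<n = +-cancelʳ-< b a n (<-≤-trans s<2n (subst (_≤ n + b) (sym (2n≡n+n n)) (+-monoʳ-≤ n (≮⇒≥ b≮n))))

  crossing-axis : ∀ n d₀ {x} → IsBlack n x → ¬ WhiteEndedOf n d₀ (lineOf n d₀ x) → CrossingAxis n d₀ x
  crossing-axis n row      {a , b} β black-ended = crossing-from-row β (≮⇒≥ black-ended)
  crossing-axis n column   {a , b} β black-ended = crossing-from-column β (≮⇒≥ black-ended)
  crossing-axis n diagonal {a , b} β black-ended = crossing-from-diagonal β (≰⇒> black-ended)

  -- Completing a black-ended line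

  lineBlacks : ℕ → Axis → ℕ → List Tri
  lineBlacks n d l = filter (λ w → lineOf n d w ≟ l) (blacks n)

  ∈-lineBlacks⁺ : ∀ n d {l} → IsBlack n w → lineOf n d w ≡ l → w ∈ lineBlacks n d l
  ∈-lineBlacks⁺ n d {l} β on-line = ∈-filter⁺ (λ w → lineOf n d w ≟ l) (∈-blacks⁺ β) on-line

  Complete : ℕ → Axis → List Tri → ℕ → Set
  Complete n d U l = All (_∈ U) (lineBlacks n d l)

  CompleteBlackEndedLine : ℕ → List Tri → Tri → Axis → Set
  CompleteBlackEndedLine n U v d = ¬ WhiteEndedOf n d (lineOf n d v) × Complete n d U (lineOf n d v)

  ContainsBlackEndedLine : ℕ → List Tri → Set
  ContainsBlackEndedLine n U = Any (λ v → Any (CompleteBlackEndedLine n U v) axes) (blacks n)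

  complete? : ∀ n d U l → Dec (Complete n d U l)
  complete? n d U l = All.all? (_∈? U) (lineBlacks n d l)

  containsBlackEndedLine? : ∀ n → Decidable (ContainsBlackEndedLine n)
  containsBlackEndedLine? n U = any? (λ v → any? (λ d →
    ¬? (Direction.whiteEnded? (direction n d) (lineOf n d v)) ×-dec complete? n d U (lineOf n d v))
    axes) (blacks n)

  []-containsNoBlackEndedLine : ∀ n → ¬ ContainsBlackEndedLine n []
  []-containsNoBlackEndedLine n P with v , v∈blacks , P₁ ← find P with d , _ , _ , complete ← find P₁
    with () ← All.lookup complete (∈-lineBlacks⁺ n d (∈-blacks⁻ v∈blacks) refl)

  ordering-containsBlackEndedLine : ∀ {σ} → 1 ≤ n → Ordering n σ → ContainsBlackEndedLine n σ
  ordering-containsBlackEndedLine {n} n≥1 ord =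
    lose (∈-blacks⁺ {n} {0 , n} β) (lose (∈-axes row)
      (n≮n n , All.tabulate λ w∈ →
        ∈-resp-↭ (↭-sym ord) (proj₁ (∈-filter⁻ (λ w → lineOf n row w ≟ n) w∈))))
    where
    n<2n : n < 2 * n
    n<2n = subst (n <_) (sym (2n≡n+n n)) (m<m+n n n≥1)
    β : Black n 0 n
    β = mkBlack (<-≤-trans n≥1 (n≤2n n)) n<2n ≤-refl (<-≤-trans n<2n (m≤n+m (2 * n) n))

  incompleteLine : ∀ {B v} d → ¬ ContainsBlackEndedLine n B → IsBlack n v → ¬ WhiteEndedOf n d (lineOf n d v) →
                   ∃[ y ] IsBlack n y × lineOf n d y ≡ lineOf n d v × y ∉ B
  incompleteLine {n} {B} {v} d ¬P β black-ended with complete? n d B (lineOf n d v)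
  ... | yes complete = contradiction (lose (∈-blacks⁺ β) (lose (∈-axes d) (black-ended , complete))) ¬P
  ... | no incomplete with y , y∈line , y∉B ← find (All.¬All⇒Any¬ (_∈? B) _ incomplete) =
    let y∈blacks , on-line = ∈-filter⁻ (λ w → lineOf n d w ≟ lineOf n d v) y∈line
    in y , ∈-blacks⁻ y∈blacks , on-line , y∉B

  first-completion-excess : ∀ {B B′ x} → Unique B′ → All (IsBlack n) B′ → B′ ⊆ x ∷ B →
                            ¬ ContainsBlackEndedLine n B → ContainsBlackEndedLine n B′ →
                            length B′ + n ≤ length (nbhd n B′)
  first-completion-excess {n} {B} {B′} {x} B′-unique B′-black B′⊆x∷B ¬P P
    with v , v∈blacks , P₁ ← find P
    with d₀ , _ , black-ended , complete ← find P₁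
    with y , y-black , y-line , y∉B ← incompleteLine d₀ ¬P (∈-blacks⁻ v∈blacks) black-ended
    -- The line was not complete in B, so the triangle missing from B is x.
    with refl ← ∈-∷∧∉⇒≡ (B′⊆x∷B (All.lookup complete (∈-lineBlacks⁺ n d₀ y-black y-line))) y∉B
    with d , x-whiteEnded , crossing ←
           crossing-axis n d₀ y-black (subst (¬_ ∘ WhiteEndedOf n d₀) (sym y-line) black-ended) =
    subst (λ m → length B′ + m ≤ length (nbhd n B′)) (whiteEndedLines-length n d)
      (LineCounting.length-nbhd-≥ (direction n d) B′-black gaps B′-unique
                                 (whiteEndedLines n d) (whiteEndedLines-unique n d) met)
    where
    met : ∀ {l} → l ∈ whiteEndedLines n d → WhiteEndedOf n d l × ∃[ u ] u ∈ B′ × lineOf n d u ≡ l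
    met l∈ with w , w-black , w-line₀ , w-line ← crossing l∈ =
      ∈-whiteEndedLines⇒WhiteEnded n d l∈ ,
      w , All.lookup complete (∈-lineBlacks⁺ n d₀ w-black (trans w-line₀ y-line)) , w-line

    gaps : ∀ {u} → u ∈ B′ → ¬ WhiteEndedOf n d (lineOf n d u) →
           ∃[ z ] IsBlack n z × lineOf n d z ≡ lineOf n d u × z ∉ B′
    gaps u∈B′ u-blackEnded
      with z , z-black , z-line , z∉B ← incompleteLine d ¬P (All.lookup B′-black u∈B′) u-blackEnded =
      z , z-black , z-line , z∉B′
      where
      z∉B′ : z ∉ B′
      z∉B′ z∈B′ with B′⊆x∷B z∈B′
      ... | here refl = u-blackEnded (subst (WhiteEndedOf n d) z-line x-whiteEnded)
      ... | there z∈B = z∉B z∈B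

  ordering-unique : ∀ n {σ} → Ordering n σ → Unique σ
  ordering-unique n ord = Unique-resp-↭ (↭⇒↭ₛ (↭-sym ord)) (blacks-unique n)

  ordering-black : ∀ n {σ} → Ordering n σ → All (IsBlack n) σ
  ordering-black n ord = All.tabulate (∈-blacks⁻ ∘ ∈-resp-↭ ord)

  ordering-maxExcess-≥ : ∀ {σ} → 1 ≤ n → Ordering n σ → + n ℤ.≤ maxExcess n σ
  ordering-maxExcess-≥ {n} {σ} n≥1 ord
    with k , k<len , ¬Pk , Pk+1 ← first-prefix (containsBlackEndedLine? n) ([]-containsNoBlackEndedLine n)
                                               (ordering-containsBlackEndedLine n≥1 ord)
    with x , prefix⊆ ← take-suc-⊆ σ k<len =
    ℤ.≤-trans (≤-excess n (take (suc k) σ)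
                (first-completion-excess {B = take k σ} (Unique.take⁺ (suc k) (ordering-unique n ord))
                                         (All.take⁺ (suc k) (ordering-black n ord)) prefix⊆ ¬Pk Pk+1))
              (≤-maxExcess n σ (∈-prefixExcesses n σ k<len))

open import Defs
open import Data.Nat using (ℕ; suc)
open import Data.Integer using (ℤ; +_; _≤_)
open import Data.Product using (_×_; Σ; _,_)
open import Data.List using (List)
open import Relation.Binary.PropositionalEquality using (_≡_)
open import Data.Integer.Properties using (≤-antisym)
open import Data.List.Relation.Binary.Permutation.Propositional using (↭-refl)
open HexagonExcess using (lexOrder-maxExcess-≤; ordering-maxExcess-≥)

theorem4p4 : (n : ℕ) → 1 Data.Nat.≤ n →
    Σ (List Tri) (λ σ → Ordering n σ × maxExcess n σ ≡ + n)
    × ((σ : List Tri) → Ordering n σ → + n ≤ maxExcess n σ)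
theorem4p4 n n≥1 =
  (blacks n , ↭-refl , ≤-antisym (lexOrder-maxExcess-≤ n) (ordering-maxExcess-≥ n≥1 ↭-refl)) ,
  (λ σ → ordering-maxExcess-≥ n≥1)
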